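{- Let $F/K$ be a field extension. If $\mathfrak{P}$ is a prime of $F$ such that $t_\mathfrak{p}$ lies in the maximal ideal of $\mathcal{O}_\mathfrak{P}$ and $\mathcal{O}_\mathfrak{p}[\gamma(F\setminus\operatorname{Poles}(\gamma))]\subseteq\mathcal{O}_\mathfrak{P}$, then $\mathfrak{P}\in\mathcal{S}^{(1,1)}_\mathfrak{p}(F)$.
   Context: $K$ is a global function field, $\mathfrak{p}$ a prime of $K$ with valuation ring $\mathcal{O}_\mathfrak{p}$, uniformizer $t_\mathfrak{p}$, and residue field $\mathbb{F}_\mathfrak{p}$ of cardinality $q$. The Kochen operator is $\gamma(x)=\frac{1}{t_\mathfrak{p}}\cdot\frac{x^q-x}{(x^q-x)^2-1}$ and $\operatorname{Poles}(\gamma)=\{a\in F:(a^q-a)^2=1\}$. For an extension $F/K$, a prime $\mathfrak{P}$ of $F$ is given by a discrete valuation $v_\mathfrak{P}$ with valuation ring $\mathcal{O}_\mathfrak{P}$ and residue field $\mathbb{F}_\mathfrak{P}$; it lies above $\mathfrak{p}$ if $\mathcal{O}_\mathfrak{P}\cap K=\mathcal{O}_\mathfrak{p}$. Put $e(\mathfrak{P}|\mathfrak{p})=v_\mathfrak{P}(t_\mathfrak{p})$, $f(\mathfrak{P}|\mathfrak{p})=[\mathbb{F}_\mathfrak{P}:\mathbb{F}_\mathfrak{p}]$, and let $\mathcal{S}^{(1,1)}_\mathfrak{p}(F)$ be the set of primes of $F$ above $\mathfrak{p}$ with $e(\mathfrak{P}|\mathfrak{p})=f(\mathfrak{P}|\mathfrak{p})=1$.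 -}

module Defs where

open import Level using (0ℓ)
open import Data.Nat as ℕ using (ℕ; zero; suc)
open import Data.Nat.Divisibility using (_∣_)
open import Data.Nat.Primality using (Prime)
open import Data.Integer as ℤ using (ℤ; +_)
open import Data.Fin using (Fin)
open import Data.List using (List; []; _∷_; foldr)
open import Data.List.Relation.Unary.Any using (Any)
open import Data.Product using (Σ; _×_; ∃; _,_)
open import Relation.Nullary using (¬_)
open import Relation.Binary.PropositionalEquality using (_≡_)
open import Algebra.Bundles using (CommutativeRing)
open import Algebra.Morphism.Structures using (module RingMorphisms)

record Field : Set₁ where
  field
    commutativeRing : CommutativeRing 0ℓ 0ℓ
  open CommutativeRing commutativeRing public
  field
    0≉1      : ¬ (0# ≈ 1#)
    _⁻¹      : Carrier → Carrier
    ⁻¹-cong  : ∀ {x y} → x ≈ y → (x ⁻¹) ≈ (y ⁻¹)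
    inverseʳ : ∀ x → ¬ (x ≈ 0#) → (x * (x ⁻¹)) ≈ 1#

  natCast : ℕ → Carrier
  natCast zero    = 0#
  natCast (suc n) = 1# + natCast n

  infixr 8 _^_
  _^_ : Carrier → ℕ → Carrier
  x ^ zero  = 1#
  x ^ suc n = x * (x ^ n)

  sumFin : (n : ℕ) → (Fin n → Carrier) → Carrier
  sumFin zero    f = 0#
  sumFin (suc n) f = f Fin.zero + sumFin n (λ i → f (Fin.suc i))
    where import Data.Fin as Fin

  -- evaluation at x of the polynomial with coefficients (c₀ ∷ c₁ ∷ …)
  -- taken in the prime field (c ↦ c · 1)
  evalPoly : Carrier → List ℕ → Carrier
  evalPoly x cs = foldr (λ c acc → natCast c + x * acc) 0# cs

record IsGlobalFunctionField (K : Field) : Set where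
  open Field K
  field
    char          : ℕ
    char-prime    : Prime char
    char-kills    : natCast char ≈ 0#
    x             : Carrier
    transcendental : ∀ (cs : List ℕ) → Any (λ c → ¬ (char ∣ c)) cs →
                     ¬ (evalPoly x cs ≈ 0#)
    -- K is finite-dimensional over 𝔽ₚ(x): spanned by finitely many b i
    dim           : ℕ
    b             : Fin dim → Carrier
    spans         : ∀ (y : Carrier) →
                    Σ (Fin dim → List ℕ) λ num →
                    Σ (Fin dim → List ℕ) λ den →
                      (∀ i → ¬ (evalPoly x (den i) ≈ 0#)) ×
                      (y ≈ sumFin dim (λ i → (evalPoly x (num i) * (evalPoly x (den i) ⁻¹)) * b i))

data ℤ∞ : Set where
  fin : ℤ → ℤ∞
  ∞   : ℤ∞

infixl 6 _+∞_
_+∞_ : ℤ∞ → ℤ∞ → ℤ∞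
fin m +∞ fin n = fin (m ℤ.+ n)
fin m +∞ ∞     = ∞
∞     +∞ _     = ∞

infix 4 _≤∞_
data _≤∞_ : ℤ∞ → ℤ∞ → Set where
  fin≤ : ∀ {m n} → m ℤ.≤ n → fin m ≤∞ fin n
  _≤∞∞ : ∀ z → z ≤∞ ∞

-- Primes = (normalized) discrete valuations v : F → ℤ ∪ {∞}

record Prime-of (F : Field) : Set where
  open Field F
  field
    v       : Carrier → ℤ∞
    v-cong  : ∀ {x y} → x ≈ y → v x ≡ v y
    v-∞⇒0   : ∀ x → v x ≡ ∞ → x ≈ 0#
    v-0     : v 0# ≡ ∞
    v-mul   : ∀ x y → v (x * y) ≡ v x +∞ v y
    v-add   : ∀ x y z → z ≤∞ v x → z ≤∞ v y → z ≤∞ v (x + y)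
    v-onto1 : ∃ λ π → v π ≡ fin (+ 1)

  _∈𝒪 : Carrier → Set
  a ∈𝒪 = fin (+ 0) ≤∞ v a

  _∈𝔪 : Carrier → Set
  a ∈𝔪 = fin (+ 1) ≤∞ v a

  -- the residue field 𝒪/𝔪 has exactly q elements:
  -- q representatives in 𝒪, pairwise incongruent mod 𝔪, covering 𝒪
  ResidueCard : ℕ → Set
  ResidueCard q =
    Σ (Fin q → Carrier) λ r →
      (∀ i → r i ∈𝒪) ×
      (∀ i j → ¬ (i ≡ j) → ¬ ((r i - r j) ∈𝔪)) ×
      (∀ y → y ∈𝒪 → ∃ λ i → (y - r i) ∈𝔪)

record Extension (K F : Field) : Set where
  module K = Field K
  module F = Field F
  open RingMorphisms K.rawRing F.rawRing
  field
    ι     : K.Carrier → F.Carrier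
    ι-hom : IsRingHomomorphism ι

module Kochen {K F : Field} (E : Extension K F)
              (𝔭 : Prime-of K) (t : Field.Carrier K) (q : ℕ) where
  open Extension E
  open Field F
  private module 𝔭 = Prime-of 𝔭

  Pole : Carrier → Set
  Pole a = ((a ^ q - a) ^ 2) ≈ 1#

  γ : Carrier → Carrier
  γ a = (ι t ⁻¹) * ((a ^ q - a) * (((a ^ q - a) ^ 2 - 1#) ⁻¹))

  data In𝒪𝔭[γ] : Carrier → Set where
    base : ∀ a → 𝔭._∈𝒪 a → In𝒪𝔭[γ] (ι a)
    gam  : ∀ a → ¬ Pole a → In𝒪𝔭[γ] (γ a)
    add  : ∀ {x y} → In𝒪𝔭[γ] x → In𝒪𝔭[γ] y → In𝒪𝔭[γ] (x + y)
    mul  : ∀ {x y} → In𝒪𝔭[γ] x → In𝒪𝔭[γ] y → In𝒪𝔭[γ] (x * y)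
    neg  : ∀ {x} → In𝒪𝔭[γ] x → In𝒪𝔭[γ] (- x)
    resp : ∀ {x y} → x ≈ y → In𝒪𝔭[γ] x → In𝒪𝔭[γ] y

module Split {K F : Field} (E : Extension K F)
             (𝔭 : Prime-of K) (t : Field.Carrier K) where
  open Extension E
  open Field F
  private module 𝔭 = Prime-of 𝔭

  LiesAbove : Prime-of F → Set
  LiesAbove 𝔓 = ∀ a → (Prime-of._∈𝒪 𝔓 (ι a) → 𝔭._∈𝒪 a) × (𝔭._∈𝒪 a → Prime-of._∈𝒪 𝔓 (ι a))

  -- e(𝔓|𝔭) = v_𝔓(t_𝔭) = 1
  e≡1 : Prime-of F → Set
  e≡1 𝔓 = Prime-of.v 𝔓 (ι t) ≡ fin (+ 1)

  -- f(𝔓|𝔭) = [𝔽_𝔓 : 𝔽_𝔭] = 1, i.e. the embedding 𝔽_𝔭 → 𝔽_𝔓 is onto: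
  -- every element of 𝒪_𝔓 is congruent mod 𝔓 to an element of 𝒪_𝔭
  f≡1 : Prime-of F → Set
  f≡1 𝔓 = ∀ y → Prime-of._∈𝒪 𝔓 y →
          ∃ λ a → 𝔭._∈𝒪 a × Prime-of._∈𝔪 𝔓 (y - ι a)

  _∈𝒮¹¹ : Prime-of F → Set
  𝔓 ∈𝒮¹¹ = LiesAbove 𝔓 × e≡1 𝔓 × f≡1 𝔓

{-# OPTIONS --safe #-}
module Submission where

open import Defs
open import Data.Nat using (ℕ)
open import Data.Integer using (+_)
open import Data.Product using (_×_)
open import Relation.Binary.PropositionalEquality using (_≡_)

open import Level using (0ℓ)
open import Algebra.Bundles using (CommutativeRing; RawRing)
open import Algebra.Morphism.Structures using (module RingMorphisms)
open import Data.Nat as ℕ using (zero; suc; _≤_; _<_; _≤′_; ≤′-refl; ≤′-step; z≤n; s≤s)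
import Data.Nat.Properties as ℕ
open import Data.Integer as ℤ using (-[1+_]; +≤+)
import Data.Integer.Properties as ℤ
open import Data.Fin using (Fin; toℕ)
open import Data.Fin.Properties using (toℕ-injective; suc-injective; any?)
open import Data.Maybe using (Maybe; just; nothing)
open import Data.Product using (∃; _,_; proj₁; proj₂; swap)
open import Data.Empty using (⊥; ⊥-elim)
open import Function using (_∘_)
open import Relation.Nullary using (¬_; Dec; yes; no; contradiction)
open import Relation.Nullary.Decidable using (map′)
open import Relation.Binary.PropositionalEquality as ≡ using (_≢_)
import Tactic.RingSolver.Core.AlmostCommutativeRing as Tactic
import Tactic.RingSolver.NonReflective as NonReflective

-- The key identity is  a^q − a = t · γ(a) · ((a^q − a)² − 1)  for every non-pole a,
-- so t divides a^q − a in 𝒪_𝔓 whenever a^q − a is 𝔓-integral.  For a uniformizer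
-- π of 𝔓 the element π^q − π has valuation exactly 1, which forces v_𝔓(t) = 1.
-- For z ∈ 𝒪_𝔓 with z^q − z ∉ 𝔓, the values of a ↦ a^q − a are congruent mod 𝔓 on
-- z + 𝔓, so z + π, …, z + π^(2q+1) would all be poles, i.e. 2q + 1 roots of the
-- polynomial (X^q − X)² − 1 of degree 2q.  Hence every residue of 𝒪_𝔓 is a root of
-- X^q − X; the q residues of 𝒪_𝔭 already are, so counting roots in 𝔽_𝔓 gives
-- f = 1.  Finally ι(𝒪_𝔭) ⊆ 𝒪_𝔓, and for a ∉ 𝒪_𝔭 the element 1/(a t) ∈ 𝒪_𝔭
-- shows ι a ∉ 𝒪_𝔓.

fin-injective : ∀ {m n} → fin m ≡ fin n → m ≡ n
fin-injective ≡.refl = ≡.refl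

+∞-identityˡ : ∀ a → fin (+ 0) +∞ a ≡ a
+∞-identityˡ (fin m) = ≡.cong fin (ℤ.+-identityˡ m)
+∞-identityˡ ∞       = ≡.refl

+∞-identityʳ : ∀ a → a +∞ fin (+ 0) ≡ a
+∞-identityʳ (fin m) = ≡.cong fin (ℤ.+-identityʳ m)
+∞-identityʳ ∞       = ≡.refl

+∞-mono-≤∞ : ∀ {w x y z} → w ≤∞ x → y ≤∞ z → w +∞ y ≤∞ x +∞ z
+∞-mono-≤∞ (fin≤ w≤x) (fin≤ y≤z)            = fin≤ (ℤ.+-mono-≤ w≤x y≤z)
+∞-mono-≤∞ {w} {fin _} {y} (fin≤ _) (_ ≤∞∞) = (w +∞ y) ≤∞∞
+∞-mono-≤∞ {w} {∞} {y} (_ ≤∞∞) _            = (w +∞ y) ≤∞∞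

_≤∞?_ : ∀ a b → Dec (a ≤∞ b)
a     ≤∞? ∞     = yes (a ≤∞∞)
∞     ≤∞? fin _ = no λ ()
fin m ≤∞? fin n = map′ fin≤ (λ { (fin≤ m≤n) → m≤n }) (m ℤ.≤? n)

≤∞-squeeze : ∀ {n a} → fin (+ n) ≤∞ a → ¬ fin (+ suc n) ≤∞ a → a ≡ fin (+ n)
≤∞-squeeze {a = fin (+ m)} (fin≤ (+≤+ n≤m)) 1+n≰m =
  ≡.cong (fin ∘ +_) (ℕ.≤-antisym (ℕ.≤-pred (ℕ.≰⇒> (1+n≰m ∘ fin≤ ∘ +≤+))) n≤m)
≤∞-squeeze {a = fin -[1+ _ ]} (fin≤ ()) _
≤∞-squeeze {a = ∞} _ 1+n≰∞ = contradiction (_ ≤∞∞) 1+n≰∞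

+∞-inverse : ∀ {m b} → fin m +∞ b ≡ fin (+ 0) → b ≡ fin (ℤ.- m)
+∞-inverse {m} {fin n} m+n≡0 = ≡.cong fin (inverseʳ-unique m n (fin-injective m+n≡0))
  where open import Algebra.Properties.AbelianGroup ℤ.+-0-abelianGroup using (inverseʳ-unique)

+∞≡0⇒1≤∞ : ∀ {a b} → a +∞ b ≡ fin (+ 0) → ¬ fin (+ 0) ≤∞ a → fin (+ 1) ≤∞ b
+∞≡0⇒1≤∞ {fin (+ _)}    _     0≰a = contradiction (fin≤ (+≤+ z≤n)) 0≰a
+∞≡0⇒1≤∞ {fin -[1+ _ ]} a+b≡0 _   =
  ≡.subst (_ ≤∞_) (≡.sym (+∞-inverse a+b≡0)) (fin≤ (+≤+ (s≤s z≤n)))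

a+a≡0⇒a≡0 : ∀ {a} → a +∞ a ≡ fin (+ 0) → a ≡ fin (+ 0)
a+a≡0⇒a≡0 {fin (+ zero)}    _  = ≡.refl
a+a≡0⇒a≡0 {fin (+ suc _)}   ()
a+a≡0⇒a≡0 {fin -[1+ _ ]}    ()

distinct⇒1<n : ∀ {n} {i j : Fin n} → i ≢ j → 1 < n
distinct⇒1<n {suc (suc _)} _               = s≤s (s≤s z≤n)
distinct⇒1<n {suc zero} {Fin.zero} {Fin.zero} i≢j = contradiction ≡.refl i≢j

-- The ring solver over an abstract commutative ring needs coefficients in which
-- cancellation such as x − x ≈ 0 can be detected; we use integers, written as
-- differences m − n of pairs (m , n) of naturals.
module IntegerRingSolver (R : CommutativeRing 0ℓ 0ℓ) where
  open CommutativeRing R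
  open import Algebra.Properties.Ring ring
    using (-‿distribˡ-*; -‿distribʳ-*; -‿involutive; -‿+-comm; -0#≈0#;
           ⁻¹-anti-homo‿-; x∙y⁻¹≈ε⇒x≈y)
  open import Algebra.Properties.Semiring.Mult semiring using (×-congˡ; ×-homo-+; ×1-homo-*)
    renaming (_×_ to _×ᵣ_)
  open import Algebra.Solver.Ring.AlmostCommutativeRing
    using (fromCommutativeRing; _-Raw-AlmostCommutative⟶_)
  open import Relation.Binary.Reasoning.Setoid setoid
  open NonReflective (Tactic.fromCommutativeRing R (λ _ → nothing))
    using (_⊜_; _⊕_; _⊗_) renaming (solve to rearrange)

  differences : RawRing 0ℓ 0ℓ
  differences = record
    { Carrier = ℕ × ℕ
    ; _≈_     = _≡_
    ; _+_     = λ { (a , b) (c , d) → a ℕ.+ c , b ℕ.+ d }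
    ; _*_     = λ { (a , b) (c , d) → a ℕ.* c ℕ.+ b ℕ.* d , a ℕ.* d ℕ.+ b ℕ.* c }
    ; -_      = swap
    ; 0#      = 0 , 0
    ; 1#      = 1 , 0
    }

  ⟦_⟧ : ℕ × ℕ → Carrier
  ⟦ m , n ⟧ = m ×ᵣ 1# - n ×ᵣ 1#

  +-diff : ∀ A B C D → (A + C) - (B + D) ≈ (A - B) + (C - D)
  +-diff A B C D = begin
    (A + C) - (B + D)
      ≈⟨ +-congˡ (-‿+-comm B D) ⟨
    (A + C) + (- B + - D)
      ≈⟨ rearrange 4 (λ a c b d → ((a ⊕ c) ⊕ (b ⊕ d)) ⊜ ((a ⊕ b) ⊕ (c ⊕ d))) refl A C (- B) (- D) ⟩
    (A - B) + (C - D)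
      ∎

  *-diff : ∀ A B C D → (A * C + B * D) - (A * D + B * C) ≈ (A - B) * (C - D)
  *-diff A B C D = sym (begin
    (A - B) * (C - D)
      ≈⟨ rearrange 4 (λ a b c d → ((a ⊕ b) ⊗ (c ⊕ d)) ⊜ ((a ⊗ c ⊕ b ⊗ d) ⊕ (a ⊗ d ⊕ b ⊗ c)))
                   refl A (- B) C (- D) ⟩
    (A * C + - B * - D) + (A * - D + - B * C)
      ≈⟨ +-cong (+-congˡ -B*-D≈BD) (+-cong (sym (-‿distribʳ-* A D)) (sym (-‿distribˡ-* B C))) ⟩
    (A * C + B * D) + (- (A * D) + - (B * C))
      ≈⟨ +-congˡ (-‿+-comm _ _) ⟩
    (A * C + B * D) - (A * D + B * C) ∎)
    where
    -B*-D≈BD : - B * - D ≈ B * D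
    -B*-D≈BD =
      trans (sym (-‿distribˡ-* B (- D))) (trans (-‿cong (sym (-‿distribʳ-* B D))) (-‿involutive _))

  cross-diff : ∀ {A B C D} → A + D ≈ C + B → A - B ≈ C - D
  cross-diff {A} {B} {C} {D} A+D≈C+B = x∙y⁻¹≈ε⇒x≈y _ _ (begin
    (A - B) - (C - D)
      ≈⟨ +-congˡ (⁻¹-anti-homo‿- C D) ⟩
    (A - B) + (D - C)
      ≈⟨ rearrange 4 (λ a b c d → ((a ⊕ b) ⊕ (d ⊕ c)) ⊜ ((a ⊕ d) ⊕ (c ⊕ b))) refl A (- B) (- C) D ⟩
    (A + D) + (- C + - B)
      ≈⟨ +-cong A+D≈C+B (-‿+-comm C B) ⟩
    (C + B) - (C + B)
      ≈⟨ -‿inverseʳ _ ⟩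
    0# ∎)

  ⟦⟧-homomorphism : differences -Raw-AlmostCommutative⟶ fromCommutativeRing R
  ⟦⟧-homomorphism = record
    { ⟦_⟧    = ⟦_⟧
    ; +-homo = λ { (a , b) (c , d) →
        trans (+-cong (×-homo-+ 1# a c) (-‿cong (×-homo-+ 1# b d))) (+-diff _ _ _ _) }
    ; *-homo = λ { (a , b) (c , d) →
        trans (+-cong (×-product a c b d) (-‿cong (×-product a d b c))) (*-diff _ _ _ _) }
    ; -‿homo = λ { (a , b) → sym (⁻¹-anti-homo‿- (a ×ᵣ 1#) (b ×ᵣ 1#)) }
    ; 0-homo = -‿inverseʳ 0#
    ; 1-homo = trans (+-congˡ -0#≈0#) (trans (+-identityʳ _) (+-identityʳ 1#))
    }
    where
    ×-product : ∀ a c b d →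
                (a ℕ.* c ℕ.+ b ℕ.* d) ×ᵣ 1# ≈ (a ×ᵣ 1#) * (c ×ᵣ 1#) + (b ×ᵣ 1#) * (d ×ᵣ 1#)
    ×-product a c b d =
      trans (×-homo-+ 1# (a ℕ.* c) (b ℕ.* d)) (+-cong (×1-homo-* a c) (×1-homo-* b d))

  _≟-diff_ : ∀ x y → Maybe (⟦ x ⟧ ≈ ⟦ y ⟧)
  (a , b) ≟-diff (c , d) with a ℕ.+ d ℕ.≟ c ℕ.+ b
  ... | yes a+d≡c+b =
    just (cross-diff (trans (sym (×-homo-+ 1# a d)) (trans (×-congˡ a+d≡c+b) (×-homo-+ 1# c b))))
  ... | no _        = nothing

  open import Algebra.Solver.Ring differences (fromCommutativeRing R) ⟦⟧-homomorphism _≟-diff_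
    public using (solve; _:=_; _:+_; _:-_; _:*_)

module Valuation {F : Field} (𝔓 : Prime-of F) where
  open Field F
  open Prime-of 𝔓
  open import Algebra.Properties.Ring ring using (-1*x≈-x; -‿involutive; -0#≈0#)
  open import Algebra.Properties.Ring ℤ.+-*-ring using (x+x≈x⇒x≈0)
  open IntegerRingSolver commutativeRing using (solve; _:=_; _:+_; _:-_; _:*_)

  ≤v-resp : ∀ {x y z} → x ≈ y → z ≤∞ v x → z ≤∞ v y
  ≤v-resp x≈y = ≡.subst (_ ≤∞_) (v-cong x≈y)

  ≤v-* : ∀ {x y z₁ z₂} → z₁ ≤∞ v x → z₂ ≤∞ v y → z₁ +∞ z₂ ≤∞ v (x * y)
  ≤v-* {x} {y} p q = ≡.subst (_ ≤∞_) (≡.sym (v-mul x y)) (+∞-mono-≤∞ p q)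

  ≤v-*-∈𝒪 : ∀ {x y z} → z ≤∞ v x → y ∈𝒪 → z ≤∞ v (x * y)
  ≤v-*-∈𝒪 {z = z} p y∈𝒪 = ≡.subst (_≤∞ _) (+∞-identityʳ z) (≤v-* p y∈𝒪)

  v≡fin⇒≉0 : ∀ {x m} → v x ≡ fin m → ¬ x ≈ 0#
  v≡fin⇒≉0 {x} vx≡m x≈0 with ≡.trans (≡.sym vx≡m) (≡.trans (v-cong x≈0) v-0)
  ... | ()

  ≈0? : ∀ x → Dec (x ≈ 0#)
  ≈0? x with v x in vx≡
  ... | ∞     = yes (v-∞⇒0 x vx≡)
  ... | fin _ = no (v≡fin⇒≉0 vx≡)

  v-1 : v 1# ≡ fin (+ 0)
  v-1 with v 1# in v1≡
  ... | ∞     = ⊥-elim (0≉1 (sym (v-∞⇒0 1# v1≡)))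
  ... | fin m = ≡.cong fin (x+x≈x⇒x≈0 m (fin-injective (begin
    fin (m ℤ.+ m)  ≡⟨ ≡.cong₂ _+∞_ v1≡ v1≡ ⟨
    v 1# +∞ v 1#   ≡⟨ v-mul 1# 1# ⟨
    v (1# * 1#)    ≡⟨ v-cong (*-identityˡ 1#) ⟩
    v 1#           ≡⟨ v1≡ ⟩
    fin m          ∎)))
    where open ≡.≡-Reasoning

  v-neg : ∀ x → v (- x) ≡ v x
  v-neg x = begin
    v (- x)               ≡⟨ v-cong (-1*x≈-x x) ⟨
    v (- 1# * x)          ≡⟨ v-mul (- 1#) x ⟩
    v (- 1#) +∞ v x       ≡⟨ ≡.cong (_+∞ v x) v-‿1 ⟩
    fin (+ 0) +∞ v x      ≡⟨ +∞-identityˡ (v x) ⟩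
    v x                   ∎
    where
    open ≡.≡-Reasoning
    v-‿1 : v (- 1#) ≡ fin (+ 0)
    v-‿1 = a+a≡0⇒a≡0 (≡.trans (≡.sym (v-mul (- 1#) (- 1#)))
                      (≡.trans (v-cong (trans (-1*x≈-x (- 1#)) (-‿involutive 1#))) v-1))

  ≤v-- : ∀ {x y z} → z ≤∞ v x → z ≤∞ v y → z ≤∞ v (x - y)
  ≤v-- {x} {y} {z} p q = v-add x (- y) z p (≡.subst (z ≤∞_) (≡.sym (v-neg y)) q)

  ≤v-by-difference : ∀ {x y z} → z ≤∞ v y → z ≤∞ v (y - x) → z ≤∞ v x
  ≤v-by-difference {x} {y} p q = ≤v-resp y-[y-x]≈x (≤v-- p q)
    where
    y-[y-x]≈x : y - (y - x) ≈ x
    y-[y-x]≈x = solve 2 (λ x y → y :- (y :- x) := x) refl x y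

  0∈𝔪 : 0# ∈𝔪
  0∈𝔪 = ≡.subst (_ ≤∞_) (≡.sym v-0) (_ ≤∞∞)

  1∈𝒪 : 1# ∈𝒪
  1∈𝒪 = ≡.subst (_ ≤∞_) (≡.sym v-1) (fin≤ ℤ.≤-refl)

  1∉𝔪 : ¬ 1# ∈𝔪
  1∉𝔪 1∈𝔪 with ≡.subst (_ ≤∞_) v-1 1∈𝔪
  ... | fin≤ (+≤+ ())

  𝔪⊆𝒪 : ∀ {x} → x ∈𝔪 → x ∈𝒪
  𝔪⊆𝒪 {x} = weaken (v x)
    where
    weaken : ∀ a → fin (+ 1) ≤∞ a → fin (+ 0) ≤∞ a
    weaken (fin _) (fin≤ 1≤m) = fin≤ (ℤ.≤-trans (+≤+ z≤n) 1≤m)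
    weaken ∞       _          = _ ≤∞∞

  ^-∈𝒪 : ∀ {x} → x ∈𝒪 → ∀ n → (x ^ n) ∈𝒪
  ^-∈𝒪 x∈𝒪 zero    = 1∈𝒪
  ^-∈𝒪 x∈𝒪 (suc n) = ≤v-* x∈𝒪 (^-∈𝒪 x∈𝒪 n)

  ^-cong-𝔪 : ∀ {x y} → x ∈𝒪 → y ∈𝒪 → (x - y) ∈𝔪 → ∀ n → (x ^ n - y ^ n) ∈𝔪
  ^-cong-𝔪 _ _ _ zero = ≤v-resp (sym (-‿inverseʳ 1#)) 0∈𝔪
  ^-cong-𝔪 {x} {y} x∈𝒪 y∈𝒪 x-y∈𝔪 (suc n) =
    ≤v-resp (sym (telescope x y (x ^ n) (y ^ n)))
      (v-add _ _ _ (≤v-* x∈𝒪 (^-cong-𝔪 x∈𝒪 y∈𝒪 x-y∈𝔪 n)) (≤v-* x-y∈𝔪 (^-∈𝒪 y∈𝒪 n)))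
    where
    telescope : ∀ x y xⁿ yⁿ → x * xⁿ - y * yⁿ ≈ x * (xⁿ - yⁿ) + (x - y) * yⁿ
    telescope = solve 4 (λ x y xⁿ yⁿ →
      x :* xⁿ :- y :* yⁿ := x :* (xⁿ :- yⁿ) :+ (x :- y) :* yⁿ) refl

  v-uniformizer-^ : ∀ {π} → v π ≡ fin (+ 1) → ∀ n → v (π ^ n) ≡ fin (+ n)
  v-uniformizer-^ vπ≡1 zero    = v-1
  v-uniformizer-^ {π} vπ≡1 (suc n) =
    ≡.trans (v-mul π (π ^ n)) (≡.cong₂ _+∞_ vπ≡1 (v-uniformizer-^ vπ≡1 n))

  v-*-⁻¹ : ∀ {x} → ¬ x ≈ 0# → v x +∞ v (x ⁻¹) ≡ fin (+ 0)
  v-*-⁻¹ {x} x≉0 = ≡.trans (≡.sym (v-mul x (x ⁻¹))) (≡.trans (v-cong (inverseʳ x x≉0)) v-1)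

  v-⁻¹ : ∀ {x m} → v x ≡ fin m → v (x ⁻¹) ≡ fin (ℤ.- m)
  v-⁻¹ {x} vx≡m =
    +∞-inverse (≡.trans (≡.cong (_+∞ v (x ⁻¹)) (≡.sym vx≡m)) (v-*-⁻¹ (v≡fin⇒≉0 vx≡m)))

  ∉𝒪⇒≉0 : ∀ {x} → ¬ x ∈𝒪 → ¬ x ≈ 0#
  ∉𝒪⇒≉0 x∉𝒪 x≈0 = x∉𝒪 (≤v-resp (sym x≈0) (𝔪⊆𝒪 0∈𝔪))

  ∉𝒪⇒⁻¹∈𝔪 : ∀ {x} → ¬ x ∈𝒪 → (x ⁻¹) ∈𝔪
  ∉𝒪⇒⁻¹∈𝔪 x∉𝒪 = +∞≡0⇒1≤∞ (v-*-⁻¹ (∉𝒪⇒≉0 x∉𝒪)) x∉𝒪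

  unit⇒⁻¹∈𝒪 : ∀ {x} → v x ≡ fin (+ 0) → (x ⁻¹) ∈𝒪
  unit⇒⁻¹∈𝒪 vx≡0 = ≡.subst (_ ≤∞_) (≡.sym (v-⁻¹ vx≡0)) (fin≤ ℤ.≤-refl)

  *-inverse⇒unit : ∀ {x y} → x ∈𝒪 → y ∈𝒪 → x * y ≈ 1# → v x ≡ fin (+ 0)
  *-inverse⇒unit x∈𝒪 y∈𝒪 xy≈1 = ≤∞-squeeze x∈𝒪 λ x∈𝔪 → 1∉𝔪 (≤v-resp xy≈1 (≤v-* x∈𝔪 y∈𝒪))

  unit-cancel : ∀ {u y} → v u ≡ fin (+ 0) → (u * y) ∈𝔪 → y ∈𝔪
  unit-cancel {u} {y} vu≡0 uy∈𝔪 =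
    ≡.subst (_ ≤∞_) (≡.trans (v-mul u y) (≡.trans (≡.cong (_+∞ v y) vu≡0) (+∞-identityˡ (v y))))
      uy∈𝔪

  residue-card⇒1<q : ∀ {q} → ResidueCard q → 1 < q
  residue-card⇒1<q (r , _ , _ , covers) with covers 0# (𝔪⊆𝒪 0∈𝔪) | covers 1# 1∈𝒪
  ... | i , 0-rᵢ∈𝔪 | j , 1-rⱼ∈𝔪 = distinct⇒1<n i≢j
    where
    shift : ∀ a b c → (a - c) - (b - c) ≈ a - b
    shift = solve 3 (λ a b c → (a :- c) :- (b :- c) := a :- b) refl
    i≢j : i ≢ j
    i≢j ≡.refl = 1∉𝔪 (≤v-resp (trans (shift 1# 0# (r i)) (trans (+-congˡ -0#≈0#) (+-identityʳ 1#)))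
                              (≤v-- 1-rⱼ∈𝔪 0-rᵢ∈𝔪))

module PolynomialFunctions (R : CommutativeRing 0ℓ 0ℓ) where
  open CommutativeRing R
  open import Algebra.Properties.Ring ring using (-1*x≈-x; x[y-z]≈xy-xz)
  open import Algebra.Properties.CommutativeSemigroup *-commutativeSemigroup using (x∙yz≈y∙xz)
  open IntegerRingSolver R using (solve; _:=_; _:+_; _:-_; _:*_)
  open import Relation.Binary.Reasoning.Setoid setoid

  -- f is a polynomial function of degree ≤ n with coefficient c at xⁿ,
  -- characterised through the factor theorem.
  PolyFn : ℕ → Carrier → (Carrier → Carrier) → Set
  PolyFn zero    c f = ∀ x → f x ≈ c
  PolyFn (suc n) c f = ∀ a → ∃ λ g → PolyFn n c g × (∀ x → f x - f a ≈ (x - a) * g x)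

  PolyFn-resp : ∀ n {c c′ f f′} → c ≈ c′ → (∀ x → f x ≈ f′ x) → PolyFn n c f → PolyFn n c′ f′
  PolyFn-resp zero    c≈c′ f≈f′ f≈c x = trans (sym (f≈f′ x)) (trans (f≈c x) c≈c′)
  PolyFn-resp (suc n) c≈c′ f≈f′ f-poly a with f-poly a
  ... | g , g-poly , f-factor =
    g , PolyFn-resp n c≈c′ (λ _ → refl) g-poly ,
    λ x → trans (+-cong (sym (f≈f′ x)) (-‿cong (sym (f≈f′ a)))) (f-factor x)

  PolyFn-id : PolyFn 1 1# (λ x → x)
  PolyFn-id a = (λ _ → 1#) , (λ _ → refl) , λ x → sym (*-identityʳ _)

  PolyFn-lift : ∀ n {c f} → PolyFn n c f → PolyFn (suc n) 0# f
  PolyFn-lift zero    f≈c    a = (λ _ → 0#) , (λ _ → refl) ,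
    λ x → trans (+-cong (f≈c x) (-‿cong (f≈c a))) (trans (-‿inverseʳ _) (sym (zeroʳ _)))
  PolyFn-lift (suc n) f-poly a with f-poly a
  ... | g , g-poly , f-factor = g , PolyFn-lift n g-poly , f-factor

  PolyFn-raise : ∀ {m n f} → m ≤ n → PolyFn m 0# f → PolyFn n 0# f
  PolyFn-raise m≤n = raise (ℕ.≤⇒≤′ m≤n)
    where
    raise : ∀ {m n f} → m ≤′ n → PolyFn m 0# f → PolyFn n 0# f
    raise ≤′-refl              f-poly = f-poly
    raise (≤′-step {n = n} m≤n) f-poly = PolyFn-lift n (raise m≤n f-poly)

  PolyFn-+ : ∀ n {c d f g} → PolyFn n c f → PolyFn n d g → PolyFn n (c + d) (λ x → f x + g x)
  PolyFn-+ zero    f≈c g≈d x = +-cong (f≈c x) (g≈d x)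
  PolyFn-+ (suc n) {f = f} {g} f-poly g-poly a with f-poly a | g-poly a
  ... | f′ , f′-poly , f-factor | g′ , g′-poly , g-factor =
    (λ x → f′ x + g′ x) , PolyFn-+ n f′-poly g′-poly , λ x → begin
      (f x + g x) - (f a + g a)       ≈⟨ +-diff (f x) (f a) (g x) (g a) ⟩
      (f x - f a) + (g x - g a)       ≈⟨ +-cong (f-factor x) (g-factor x) ⟩
      (x - a) * f′ x + (x - a) * g′ x ≈⟨ distribˡ _ _ _ ⟨
      (x - a) * (f′ x + g′ x)         ∎
    where
    +-diff : ∀ a b c d → (a + c) - (b + d) ≈ (a - b) + (c - d)
    +-diff = solve 4 (λ a b c d → (a :+ c) :- (b :+ d) := (a :- b) :+ (c :- d)) refl

  PolyFn-scale : ∀ n k {c f} → PolyFn n c f → PolyFn n (k * c) (λ x → k * f x)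
  PolyFn-scale zero    k f≈c x = *-congˡ (f≈c x)
  PolyFn-scale (suc n) k {f = f} f-poly a with f-poly a
  ... | g , g-poly , f-factor =
    (λ x → k * g x) , PolyFn-scale n k g-poly , λ x → begin
      k * f x - k * f a   ≈⟨ x[y-z]≈xy-xz k (f x) (f a) ⟨
      k * (f x - f a)     ≈⟨ *-congˡ (f-factor x) ⟩
      k * ((x - a) * g x) ≈⟨ x∙yz≈y∙xz k (x - a) (g x) ⟩
      (x - a) * (k * g x) ∎

  PolyFn-* : ∀ n m {c d f g} → PolyFn n c f → PolyFn m d g →
             PolyFn (n ℕ.+ m) (c * d) (λ x → f x * g x)
  PolyFn-* zero    m {c} f≈c g-poly =
    PolyFn-resp m refl (λ x → *-congʳ (sym (f≈c x))) (PolyFn-scale m c g-poly)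
  PolyFn-* (suc n) m {f = f} {g} f-poly g-poly a with f-poly a | PolyFn-lift m g-poly a
  ... | f′ , f′-poly , f-factor | g′ , g′-poly , g-factor =
    (λ x → f′ x * g x + f a * g′ x) ,
    PolyFn-resp (n ℕ.+ m) (trans (+-congˡ (zeroʳ (f a))) (+-identityʳ _)) (λ _ → refl)
      (PolyFn-+ (n ℕ.+ m) (PolyFn-* n m f′-poly g-poly)
        (PolyFn-scale (n ℕ.+ m) (f a) (PolyFn-raise (ℕ.m≤n+m m n) g′-poly))) ,
    λ x → begin
      f x * g x - f a * g a
        ≈⟨ product-rule (f x) (f a) (g x) (g a) ⟩
      (f x - f a) * g x + f a * (g x - g a)
        ≈⟨ +-cong (*-congʳ (f-factor x)) (*-congˡ (g-factor x)) ⟩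
      ((x - a) * f′ x) * g x + f a * ((x - a) * g′ x)
        ≈⟨ collect (x - a) (f′ x) (g x) (f a) (g′ x) ⟩
      (x - a) * (f′ x * g x + f a * g′ x) ∎
    where
    product-rule : ∀ fx fa gx ga → fx * gx - fa * ga ≈ (fx - fa) * gx + fa * (gx - ga)
    product-rule = solve 4 (λ fx fa gx ga →
      fx :* gx :- fa :* ga := (fx :- fa) :* gx :+ fa :* (gx :- ga)) refl
    collect : ∀ u f′ g fa g′ → (u * f′) * g + fa * (u * g′) ≈ u * (f′ * g + fa * g′)
    collect = solve 5 (λ u f′ g fa g′ →
      (u :* f′) :* g :+ fa :* (u :* g′) := u :* (f′ :* g :+ fa :* g′)) refl

  PolyFn-−-lower : ∀ {m n c d f g} → m < n → PolyFn n c f → PolyFn m d g →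
                   PolyFn n c (λ x → f x - g x)
  PolyFn-−-lower {m} {n} m<n f-poly g-poly =
    PolyFn-resp n (+-identityʳ _) (λ x → +-congˡ (-1*x≈-x _))
      (PolyFn-+ n f-poly (PolyFn-raise m<n (PolyFn-lift m (PolyFn-scale m (- 1#) g-poly))))

  -- Roots are counted modulo Null, and distinctness means that differences are
  -- Units: Null = (_≈ 0#) counts roots in a field, Null = (_∈𝔪) counts them in a
  -- residue field.
  module RootCounting
    (Null Unit : Carrier → Set)
    (Null-resp   : ∀ {x y} → x ≈ y → Null x → Null y)
    (Null-−      : ∀ {x y} → Null x → Null y → Null (x - y))
    (Unit-cancel : ∀ {u y} → Unit u → Null (u * y) → Null y)
    where

    no-deg+1-distinct-roots :
      ∀ n {c f} → PolyFn n c f → ¬ Null c → (α : Fin (suc n) → Carrier) →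
      (∀ i → Null (f (α i))) → (∀ i j → i ≢ j → Unit (α i - α j)) → ⊥
    no-deg+1-distinct-roots zero f≈c c∉ α roots _ =
      c∉ (Null-resp (f≈c (α Fin.zero)) (roots Fin.zero))
    no-deg+1-distinct-roots (suc n) f-poly c∉ α roots distinct with f-poly (α Fin.zero)
    ... | g , g-poly , f-factor =
      no-deg+1-distinct-roots n g-poly c∉ (α ∘ Fin.suc)
        (λ i → Unit-cancel (distinct (Fin.suc i) Fin.zero λ ())
                 (Null-resp (f-factor (α (Fin.suc i)))
                   (Null-− (roots (Fin.suc i)) (roots Fin.zero))))
        (λ i j i≢j → distinct (Fin.suc i) (Fin.suc j) (i≢j ∘ suc-injective))

module FieldProperties (F : Field) where
  open Field F
  open PolynomialFunctions commutativeRing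
  open import Algebra.Properties.CommutativeSemigroup *-commutativeSemigroup using (xy∙z≈y∙xz)
  open import Relation.Binary.Reasoning.Setoid setoid

  PolyFn-^ : ∀ n → PolyFn n 1# (λ x → x ^ n)
  PolyFn-^ zero    _ = refl
  PolyFn-^ (suc n) =
    PolyFn-resp (suc n) (*-identityˡ 1#) (λ _ → refl) (PolyFn-* 1 n PolyFn-id (PolyFn-^ n))

  ≉0-cancelˡ : ∀ {u y} → ¬ u ≈ 0# → u * y ≈ 0# → y ≈ 0#
  ≉0-cancelˡ {u} {y} u≉0 uy≈0 = begin
    y                 ≈⟨ *-identityˡ y ⟨
    1# * y            ≈⟨ *-congʳ (inverseʳ u u≉0) ⟨
    (u * u ⁻¹) * y    ≈⟨ xy∙z≈y∙xz u (u ⁻¹) y ⟩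
    u ⁻¹ * (u * y)    ≈⟨ *-congˡ uy≈0 ⟩
    u ⁻¹ * 0#         ≈⟨ zeroʳ _ ⟩
    0#                ∎

module KochenIntegrality
  {K F : Field} (E : Extension K F) (𝔭 : Prime-of K) (𝔓 : Prime-of F)
  (t : Field.Carrier K) (v𝔭t≡1 : Prime-of.v 𝔭 t ≡ fin (+ 1))
  (t∈𝔓 : Prime-of._∈𝔪 𝔓 (Extension.ι E t))
  (q : ℕ) (1<q : 1 < q)
  (integral : ∀ z → Kochen.In𝒪𝔭[γ] E 𝔭 t q z → Prime-of._∈𝒪 𝔓 z)
  where
  open Field F
  open Prime-of 𝔓
  open Valuation 𝔓
  open FieldProperties F
  open PolynomialFunctions commutativeRing
  open Extension E using (ι; ι-hom)
  open RingMorphisms (Field.rawRing K) rawRing using (IsRingHomomorphism)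
  open IsRingHomomorphism ι-hom using (⟦⟧-cong; +-homo; *-homo; -‿homo; 1#-homo)
  open Kochen E 𝔭 t q
  open Split E 𝔭 t
  open IntegerRingSolver commutativeRing using (solve; _:=_; _:+_; _:-_; _:*_)
  open import Algebra.Properties.Ring ring using (x∙y⁻¹≈ε⇒x≈y; x≈y⇒x∙y⁻¹≈ε; ⁻¹-anti-homo‿-)
  open import Relation.Binary.Reasoning.Setoid setoid
  private
    module K = Field K
    module 𝔭 = Prime-of 𝔭
    module V𝔭 = Valuation 𝔭

  ι-∈𝒪 : ∀ {a} → 𝔭._∈𝒪 a → ι a ∈𝒪
  ι-∈𝒪 {a} a∈𝒪 = integral (ι a) (base a a∈𝒪)

  ι-− : ∀ a b → ι (a K.- b) ≈ ι a - ι b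
  ι-− a b = trans (+-homo a (K.- b)) (+-congˡ (-‿homo b))

  ι-*-⁻¹ : ∀ {a} → ¬ a K.≈ K.0# → ι a * ι (a K.⁻¹) ≈ 1#
  ι-*-⁻¹ {a} a≉0 = trans (sym (*-homo a (a K.⁻¹))) (trans (⟦⟧-cong (K.inverseʳ a a≉0)) 1#-homo)

  ι-unit : ∀ {a} → 𝔭._∈𝒪 a → ¬ 𝔭._∈𝔪 a → v (ι a) ≡ fin (+ 0)
  ι-unit a∈𝒪 a∉𝔪 = *-inverse⇒unit (ι-∈𝒪 a∈𝒪) (ι-∈𝒪 (V𝔭.unit⇒⁻¹∈𝒪 va≡0)) (ι-*-⁻¹ (V𝔭.v≡fin⇒≉0 va≡0))
    where va≡0 = ≤∞-squeeze a∈𝒪 a∉𝔪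

  t≉0 : ¬ t K.≈ K.0#
  t≉0 = V𝔭.v≡fin⇒≉0 v𝔭t≡1

  ιt≉0 : ¬ ι t ≈ 0#
  ιt≉0 ιt≈0 = 0≉1 (trans (sym (zeroˡ _)) (trans (*-congʳ (sym ιt≈0)) (ι-*-⁻¹ t≉0)))

  ℘ : Carrier → Carrier
  ℘ a = a ^ q - a

  ℘-∈𝒪 : ∀ {a} → a ∈𝒪 → ℘ a ∈𝒪
  ℘-∈𝒪 a∈𝒪 = ≤v-- (^-∈𝒪 a∈𝒪 q) a∈𝒪

  ℘-via-γ : ∀ {a} → ¬ Pole a → ℘ a ≈ ι t * (γ a * (℘ a ^ 2 - 1#))
  ℘-via-γ {a} a∉Poles = sym (begin
    ι t * ((ι t ⁻¹ * (℘ a * B ⁻¹)) * B) ≈⟨ regroup (ι t) (ι t ⁻¹) (℘ a) B (B ⁻¹) ⟩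
    (ι t * ι t ⁻¹) * ((B * B ⁻¹) * ℘ a) ≈⟨ *-cong (inverseʳ _ ιt≉0) (*-congʳ (inverseʳ B B≉0)) ⟩
    1# * (1# * ℘ a)                     ≈⟨ trans (*-identityˡ _) (*-identityˡ _) ⟩
    ℘ a                                 ∎)
    where
    B = ℘ a ^ 2 - 1#
    B≉0 : ¬ B ≈ 0#
    B≉0 B≈0 = a∉Poles (x∙y⁻¹≈ε⇒x≈y _ _ B≈0)
    regroup : ∀ T T′ b B B′ → T * ((T′ * (b * B′)) * B) ≈ (T * T′) * ((B * B′) * b)
    regroup = solve 5 (λ T T′ b B B′ →
      T :* ((T′ :* (b :* B′)) :* B) := (T :* T′) :* ((B :* B′) :* b)) refl

  ℘-divisible-by-t : ∀ {a z} → ¬ Pole a → ℘ a ∈𝒪 → z ≤∞ v (ι t) → z ≤∞ v (℘ a)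
  ℘-divisible-by-t {a} a∉Poles ℘a∈𝒪 z≤vt =
    ≤v-resp (sym (℘-via-γ a∉Poles))
      (≤v-*-∈𝒪 z≤vt (≤v-* (integral (γ a) (gam a a∉Poles)) (≤v-- (^-∈𝒪 ℘a∈𝒪 2) 1∈𝒪)))

  ℘∈𝔪⇒∉Poles : ∀ {a} → ℘ a ∈𝔪 → ¬ Pole a
  ℘∈𝔪⇒∉Poles ℘a∈𝔪 pole = 1∉𝔪 (≤v-resp pole (≤v-*-∈𝒪 ℘a∈𝔪 (^-∈𝒪 (𝔪⊆𝒪 ℘a∈𝔪) 1)))

  ℘-cong-𝔪 : ∀ {x y} → x ∈𝒪 → y ∈𝒪 → (x - y) ∈𝔪 → (℘ x - ℘ y) ∈𝔪
  ℘-cong-𝔪 {x} {y} x∈𝒪 y∈𝒪 x-y∈𝔪 =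
    ≤v-resp (sym (regroup x y (x ^ q) (y ^ q))) (≤v-- (^-cong-𝔪 x∈𝒪 y∈𝒪 x-y∈𝔪 q) x-y∈𝔪)
    where
    regroup : ∀ x y xq yq → (xq - x) - (yq - y) ≈ (xq - yq) - (x - y)
    regroup = solve 4 (λ x y xq yq → (xq :- x) :- (yq :- y) := (xq :- yq) :- (x :- y)) refl

  PolyFn-℘ : PolyFn q 1# ℘
  PolyFn-℘ = PolyFn-−-lower 1<q (PolyFn-^ q) PolyFn-id

  PolyFn-poles : PolyFn (q ℕ.+ q) 1# (λ x → ℘ x ^ 2 - 1#)
  PolyFn-poles = PolyFn-−-lower 0<q+q ℘²-poly (λ _ → refl)
    where
    0<q+q : 0 < q ℕ.+ q
    0<q+q = ℕ.≤-trans (ℕ.<⇒≤ 1<q) (ℕ.m≤m+n q q)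
    ℘²-poly : PolyFn (q ℕ.+ q) 1# (λ x → ℘ x ^ 2)
    ℘²-poly = PolyFn-resp (q ℕ.+ q) (*-identityˡ 1#) (λ _ → *-congˡ (sym (*-identityʳ _)))
                (PolyFn-* q q PolyFn-℘ PolyFn-℘)

  π : Carrier
  π = proj₁ v-onto1

  π∈𝔪 : π ∈𝔪
  π∈𝔪 = ≡.subst (_ ≤∞_) (≡.sym (proj₂ v-onto1)) (fin≤ ℤ.≤-refl)

  v-π^ : ∀ n → v (π ^ n) ≡ fin (+ n)
  v-π^ = v-uniformizer-^ (proj₂ v-onto1)

  π^-≥ : ∀ {m n} → m ≤ n → fin (+ m) ≤∞ v (π ^ n)
  π^-≥ {n = n} m≤n = ≡.subst (_ ≤∞_) (≡.sym (v-π^ n)) (fin≤ (+≤+ m≤n))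

  π^-injective : ∀ {m n} → π ^ m ≈ π ^ n → m ≡ n
  π^-injective {m} {n} π^m≈π^n =
    ℤ.+-injective (fin-injective (≡.trans (≡.sym (v-π^ m)) (≡.trans (v-cong π^m≈π^n) (v-π^ n))))

  lies-above : LiesAbove 𝔓
  lies-above a = ι∈𝒪⇒∈𝒪 , ι-∈𝒪
    where
    ι∈𝒪⇒∈𝒪 : ι a ∈𝒪 → 𝔭._∈𝒪 a
    ι∈𝒪⇒∈𝒪 ιa∈𝒪 with fin (+ 0) ≤∞? 𝔭.v a
    ... | yes a∈𝒪 = a∈𝒪
    ... | no  a∉𝒪 = ⊥-elim (1∉𝔪 (≤v-resp ιa*[ιc*ιt]≈1 (≤v-* ιa∈𝒪 (≤v-* (ι-∈𝒪 c∈𝒪) t∈𝔓))))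
      where
      c = a K.⁻¹ K.* t K.⁻¹
      c∈𝒪 : 𝔭._∈𝒪 c
      c∈𝒪 = V𝔭.≤v-* (V𝔭.∉𝒪⇒⁻¹∈𝔪 a∉𝒪)
              (≡.subst (fin -[1+ 0 ] ≤∞_) (≡.sym (V𝔭.v-⁻¹ v𝔭t≡1)) (fin≤ ℤ.≤-refl))
      ιa*[ιc*ιt]≈1 : ι a * (ι c * ι t) ≈ 1#
      ιa*[ιc*ιt]≈1 = begin
        ι a * (ι c * ι t)                         ≈⟨ *-congˡ (*-congʳ (*-homo _ _)) ⟩
        ι a * ((ι (a K.⁻¹) * ι (t K.⁻¹)) * ι t)   ≈⟨ regroup (ι a) (ι (a K.⁻¹)) (ι (t K.⁻¹)) (ι t) ⟩
        (ι a * ι (a K.⁻¹)) * (ι t * ι (t K.⁻¹))   ≈⟨ *-cong (ι-*-⁻¹ (V𝔭.∉𝒪⇒≉0 a∉𝒪)) (ι-*-⁻¹ t≉0) ⟩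
        1# * 1#                                   ≈⟨ *-identityˡ 1# ⟩
        1#                                        ∎
        where
        regroup : ∀ a a′ t′ t → a * ((a′ * t′) * t) ≈ (a * a′) * (t * t′)
        regroup = solve 4 (λ a a′ t′ t → a :* ((a′ :* t′) :* t) := (a :* a′) :* (t :* t′)) refl

  ramification-index≡1 : e≡1 𝔓
  ramification-index≡1 = ≤∞-squeeze t∈𝔓 2≰vt
    where
    ℘π∈𝔪 : ℘ π ∈𝔪
    ℘π∈𝔪 = ≤v-- (π^-≥ (ℕ.<⇒≤ 1<q)) π∈𝔪
    2≰vt : ¬ fin (+ 2) ≤∞ v (ι t)
    2≰vt 2≤vt with ≡.subst (_ ≤∞_) (proj₂ v-onto1)
      (≤v-by-difference (π^-≥ 1<q) (℘-divisible-by-t (℘∈𝔪⇒∉Poles ℘π∈𝔪) (𝔪⊆𝒪 ℘π∈𝔪) 2≤vt))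
    ... | fin≤ (+≤+ (s≤s ()))

  ℘-∈𝔪-of-∉Poles : ∀ {a} → a ∈𝒪 → ¬ Pole a → ℘ a ∈𝔪
  ℘-∈𝔪-of-∉Poles a∈𝒪 a∉Poles = ℘-divisible-by-t a∉Poles (℘-∈𝒪 a∈𝒪) t∈𝔓

  ℘-∉𝔪⇒nearby-poles : ∀ {z w} → z ∈𝒪 → ¬ ℘ z ∈𝔪 → (w - z) ∈𝔪 → ℘ w ^ 2 - 1# ≈ 0#
  ℘-∉𝔪⇒nearby-poles {z} {w} z∈𝒪 ℘z∉𝔪 w-z∈𝔪 with ≈0? (℘ w ^ 2 - 1#)
  ... | yes w-pole = w-pole
  ... | no  w∉Poles = contradiction
    (≤v-by-difference (℘-∈𝔪-of-∉Poles w∈𝒪 (w∉Poles ∘ x≈y⇒x∙y⁻¹≈ε)) (℘-cong-𝔪 w∈𝒪 z∈𝒪 w-z∈𝔪)) ℘z∉𝔪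
    where
    w∈𝒪 : w ∈𝒪
    w∈𝒪 = ≤v-resp (solve 2 (λ z w → z :+ (w :- z) := w) refl z w) (v-add _ _ _ z∈𝒪 (𝔪⊆𝒪 w-z∈𝔪))

  ℘-∈𝔪 : ∀ {z} → z ∈𝒪 → ℘ z ∈𝔪
  ℘-∈𝔪 {z} z∈𝒪 with fin (+ 1) ≤∞? v (℘ z)
  ... | yes ℘z∈𝔪 = ℘z∈𝔪
  ... | no  ℘z∉𝔪 =
    ⊥-elim (no-deg+1-distinct-roots (q ℕ.+ q) PolyFn-poles (0≉1 ∘ sym) z+π^ poles distinct)
    where
    open RootCounting (_≈ 0#) (λ u → ¬ u ≈ 0#) (λ x≈y x≈0 → trans (sym x≈y) x≈0)
      (λ x≈0 y≈0 → x≈y⇒x∙y⁻¹≈ε (trans x≈0 (sym y≈0))) ≉0-cancelˡ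
    shift : ∀ z a b → (z + a) - (z + b) ≈ a - b
    shift = solve 3 (λ z a b → (z :+ a) :- (z :+ b) := a :- b) refl
    z+π^ : Fin (suc (q ℕ.+ q)) → Carrier
    z+π^ i = z + π ^ suc (toℕ i)
    poles : ∀ i → ℘ (z+π^ i) ^ 2 - 1# ≈ 0#
    poles i = ℘-∉𝔪⇒nearby-poles z∈𝒪 ℘z∉𝔪
      (≤v-resp (solve 2 (λ z a → a := (z :+ a) :- z) refl z _) (π^-≥ {n = suc (toℕ i)} (s≤s z≤n)))
    distinct : ∀ i j → i ≢ j → ¬ (z+π^ i - z+π^ j) ≈ 0#
    distinct i j i≢j diff≈0 = i≢j (toℕ-injective (ℕ.suc-injective
      (π^-injective (x∙y⁻¹≈ε⇒x≈y _ _ (trans (sym (shift z _ _)) diff≈0)))))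

  residue-degree≡1 : 𝔭.ResidueCard q → f≡1 𝔓
  residue-degree≡1 (r , r∈𝒪 , r-distinct , _) y y∈𝒪 with any? (λ i → fin (+ 1) ≤∞? v (y - ι (r i)))
  ... | yes (i , y≡rᵢ) = r i , r∈𝒪 i , y≡rᵢ
  ... | no  y≢r = ⊥-elim (no-deg+1-distinct-roots q PolyFn-℘ 1∉𝔪 α α-roots α-distinct)
    where
    open RootCounting _∈𝔪 (λ u → v u ≡ fin (+ 0)) ≤v-resp ≤v-- unit-cancel
    α : Fin (suc q) → Carrier
    α Fin.zero    = y
    α (Fin.suc i) = ι (r i)
    α-roots : ∀ i → ℘ (α i) ∈𝔪
    α-roots Fin.zero    = ℘-∈𝔪 y∈𝒪
    α-roots (Fin.suc i) = ℘-∈𝔪 (ι-∈𝒪 (r∈𝒪 i))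
    y-rᵢ-unit : ∀ i → v (y - ι (r i)) ≡ fin (+ 0)
    y-rᵢ-unit i = ≤∞-squeeze (≤v-- y∈𝒪 (ι-∈𝒪 (r∈𝒪 i))) λ y≡rᵢ → y≢r (i , y≡rᵢ)
    α-distinct : ∀ i j → i ≢ j → v (α i - α j) ≡ fin (+ 0)
    α-distinct Fin.zero    Fin.zero    0≢0 = contradiction ≡.refl 0≢0
    α-distinct Fin.zero    (Fin.suc j) _   = y-rᵢ-unit j
    α-distinct (Fin.suc i) Fin.zero    _   =
      ≡.trans (v-cong (sym (⁻¹-anti-homo‿- y (ι (r i))))) (≡.trans (v-neg _) (y-rᵢ-unit i))
    α-distinct (Fin.suc i) (Fin.suc j) i≢j =
      ≡.trans (v-cong (sym (ι-− (r i) (r j))))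
        (ι-unit (V𝔭.≤v-- (r∈𝒪 i) (r∈𝒪 j)) (r-distinct i j (i≢j ∘ ≡.cong Fin.suc)))

lemma2p4 : (K : Field) → IsGlobalFunctionField K →
    (𝔭 : Prime-of K) (t : Field.Carrier K) → Prime-of.v 𝔭 t ≡ fin (+ 1) →
    (q : ℕ) → Prime-of.ResidueCard 𝔭 q →
    (F : Field) (E : Extension K F) (𝔓 : Prime-of F) →
    Prime-of._∈𝔪 𝔓 (Extension.ι E t) →
    (∀ z → Kochen.In𝒪𝔭[γ] E 𝔭 t q z → Prime-of._∈𝒪 𝔓 z) →
    Split._∈𝒮¹¹ E 𝔭 t 𝔓
lemma2p4 K _ 𝔭 t v𝔭t≡1 q residues F E 𝔓 t∈𝔓 integral =
  lies-above , ramification-index≡1 , residue-degree≡1 residues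
  where
  open KochenIntegrality E 𝔭 𝔓 t v𝔭t≡1 t∈𝔓 q (Valuation.residue-card⇒1<q 𝔭 residues) integral
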